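{- Let $f$ be an endomorphism of $\{a,b\}^*$ (with $a \prec b$) that preserves the lexicographic order on finite words. Let $i \geq 2$ be an integer and assume that $f(a^i b)$ is a Lyndon word. Then for every finite word $v$ over $\{a,b\}$ such that $a^i b v$ is a Lyndon word, the word $f(a^i b v)$ is also a Lyndon word.
   Context: The lexicographic order $\prec$ on finite words over $\{a \prec b\}$: $u \prec v$ iff $u$ is a proper prefix of $v$, or $u = x\alpha y$, $v = x\beta z$ with letters $\alpha \prec \beta$. A non-empty finite word $w$ is a Lyndon word if $w \prec s$ for every non-empty proper suffix $s$ of $w$. $f$ preserves the lexicographic order on finite words if for all finite words $u,v$, $u \prec v$ implies $f(u) \prec f(v)$. -}

module Defs where

open import Data.List using (List; []; _∷_; _++_; replicate)
open import Data.Nat using (ℕ)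
open import Data.Product using (Σ; _×_; ∃-syntax)
open import Relation.Binary.PropositionalEquality using (_≡_; _≢_)

data Letter : Set where
  a b : Letter

data _<L_ : Letter → Letter → Set where
  a<b : a <L b

Word : Set
Word = List Letter

data _≺_ : Word → Word → Set where
  prefix : ∀ u c t → u ≺ (u ++ (c ∷ t))
  differ : ∀ x α β y z → α <L β → (x ++ (α ∷ y)) ≺ (x ++ (β ∷ z))

IsEndomorphism : (Word → Word) → Set
IsEndomorphism f = (f [] ≡ []) × (∀ u v → f (u ++ v) ≡ f u ++ f v)

PreservesLex : (Word → Word) → Set
PreservesLex f = ∀ u v → u ≺ v → f u ≺ f v

IsLyndon : Word → Set
IsLyndon w = (w ≢ []) × (∀ x s → x ++ s ≡ w → x ≢ [] → s ≢ [] → w ≺ s)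

aib : ℕ → Word
aib i = replicate i a ++ (b ∷ [])

-- Let W = aⁱbv be Lyndon and p = f(aⁱb) Lyndon. A non-empty proper suffix s of
-- f(W) = p f(v) either starts at the image of a letter boundary, s = f(w) for a
-- proper suffix w of W, and then W ≺ w gives f(W) ≺ s by order preservation; or
-- it starts strictly inside the image f(c) of a letter. In the latter case the
-- suffix c w of W is at least W, hence begins with aᵏb for some k ≤ i, so s is a
-- proper suffix t of p = f(aⁱb) followed by some word. Since p ≺ t and t is not
-- longer than p, p is not a prefix of t, so p f(v) ≺ s whatever follows.
module Submission where

open import Defs
open import Data.Nat using (ℕ; suc; _≤_; _≤′_; ≤′-refl; ≤′-step)
open import Data.Nat.Properties using (m≤n+m; m+1+n≰m; s≤′s; z≤′n)
open import Data.List using (List; []; _∷_; _++_; [_]; replicate; length)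
open import Data.List.Properties using (++-assoc; ++-identityʳ; length-++; ++-identityˡ-unique; ++-conicalˡ; ++-conicalʳ; ∷-injective)
open import Data.Product using (_×_; _,_; ∃-syntax)
open import Data.Sum using (_⊎_; inj₁; inj₂)
open import Relation.Nullary using (contradiction)
open import Relation.Binary.PropositionalEquality using (_≡_; _≢_; refl; sym; trans; cong; subst; subst₂; module ≡-Reasoning)

private
  variable
    A : Set
    c : Letter
    u v w x y z t : Word

∷≢[] : {d : A} {xs : List A} → d ∷ xs ≢ []
∷≢[] ()

++-≡-++ : (xs ys us vs : List A) → xs ++ ys ≡ us ++ vs →
          (∃[ m ] xs ≡ us ++ m × vs ≡ m ++ ys) ⊎ (∃[ m ] us ≡ xs ++ m × ys ≡ m ++ vs)
++-≡-++ []       ys us       vs eq = inj₂ (us , refl , eq)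
++-≡-++ (x ∷ xs) ys []       vs eq = inj₁ (x ∷ xs , refl , sym eq)
++-≡-++ (x ∷ xs) ys (u ∷ us) vs eq with ∷-injective eq
... | refl , eq′ with ++-≡-++ xs ys us vs eq′
...   | inj₁ (m , xs≡ , vs≡) = inj₁ (m , cong (x ∷_) xs≡ , vs≡)
...   | inj₂ (m , us≡ , ys≡) = inj₂ (m , cong (x ∷_) us≡ , ys≡)

∷-++-inv : {d : A} {xs ys zs : List A} → xs ≢ [] → xs ++ ys ≡ d ∷ zs →
           ∃[ ts ] xs ≡ d ∷ ts × zs ≡ ts ++ ys
∷-++-inv {xs = []}    xs≢[] _  = contradiction refl xs≢[]
∷-++-inv {xs = _ ∷ ts} _     eq with ∷-injective eq
... | refl , refl = ts , refl , refl

-- ≺ presented by recursion on the first letters, so that it can be inverted by pattern matching.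
data _⊏_ : Word → Word → Set where
  []⊏∷  : ∀ {d t} → [] ⊏ (d ∷ t)
  head⊏ : ∀ {α β y z} → α <L β → (α ∷ y) ⊏ (β ∷ z)
  ∷⊏∷   : ∀ {d u v} → u ⊏ v → (d ∷ u) ⊏ (d ∷ v)

++⁺-⊏ : ∀ x → u ⊏ v → (x ++ u) ⊏ (x ++ v)
++⁺-⊏ []      u⊏v = u⊏v
++⁺-⊏ (_ ∷ x) u⊏v = ∷⊏∷ (++⁺-⊏ x u⊏v)

≺⇒⊏ : u ≺ v → u ⊏ v
≺⇒⊏ (prefix u d t)           = subst (_⊏ (u ++ d ∷ t)) (++-identityʳ u) (++⁺-⊏ u []⊏∷)
≺⇒⊏ (differ x α β y z α<β) = ++⁺-⊏ x (head⊏ α<β)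

≺-++ : u ≺ v → length v ≤ length u → ∀ X Y → (u ++ X) ≺ (v ++ Y)
≺-++ (prefix u d t) |v|≤|u| X Y =
  contradiction (subst (_≤ length u) (length-++ u) |v|≤|u|) (m+1+n≰m (length u))
≺-++ (differ x α β y z α<β) _ X Y
  rewrite ++-assoc x (α ∷ y) X | ++-assoc x (β ∷ z) Y = differ x α β (y ++ X) (z ++ Y) α<β

lyndon-≺-suffix-++ : IsLyndon w → w ≡ x ++ t → x ≢ [] → t ≢ [] → ∀ X Y → (w ++ X) ≺ (t ++ Y)
lyndon-≺-suffix-++ {x = x} {t} (_ , w≺suffix) refl x≢[] t≢[] =
  ≺-++ (w≺suffix x t refl x≢[] t≢[])
       (subst (length t ≤_) (sym (length-++ x)) (m≤n+m (length t) (length x)))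

aib-≤′ : ∀ {k i} → k ≤′ i → ∃[ y ] aib i ≡ y ++ aib k
aib-≤′ ≤′-refl           = [] , refl
aib-≤′ (≤′-step k≤′i) with aib-≤′ k≤′i
... | y , eq = a ∷ y , cong (a ∷_) eq

aib-++-⊏ : ∀ i → (aib i ++ v) ⊏ z → ∃[ k ] ∃[ u ] z ≡ aib k ++ u × k ≤′ i
aib-++-⊏ {z = b ∷ u} _       _                  = 0 , u , refl , z≤′n
aib-++-⊏ {z = a ∷ _} 0       (head⊏ ())
aib-++-⊏ {z = a ∷ _} (suc i) (∷⊏∷ ⊏z) with aib-++-⊏ i ⊏z
... | k , u , refl , k≤′i = suc k , u , refl , s≤′s k≤′i

lyndon-aib-++-suffix-≤′ : ∀ i → IsLyndon (aib i ++ v) → aib i ++ v ≡ y ++ z → z ≢ [] →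
                          ∃[ k ] ∃[ u ] z ≡ aib k ++ u × k ≤′ i
lyndon-aib-++-suffix-≤′ {v = v} {y = []} i _             eq _    = i , v , sym eq , ≤′-refl
lyndon-aib-++-suffix-≤′ {y = _ ∷ y}     i (_ , ≺suffix) eq z≢[] =
  aib-++-⊏ i (≺⇒⊏ (≺suffix (_ ∷ y) _ (sym eq) ∷≢[] z≢[]))

lyndon-aib-++-suffix : ∀ i → IsLyndon (aib i ++ v) → aib i ++ v ≡ y ++ c ∷ w →
                       ∃[ y′ ] ∃[ t ] ∃[ u ] aib i ≡ y′ ++ c ∷ t × w ≡ t ++ u
lyndon-aib-++-suffix i W-lyndon W≡ with lyndon-aib-++-suffix-≤′ i W-lyndon W≡ ∷≢[]
... | k , u , cw≡ , k≤′i
  with aib-≤′ k≤′i | ∷-++-inv (λ e → ∷≢[] (++-conicalʳ (replicate k a) [ b ] e)) (sym cw≡)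
... | y′ , aibi≡ | t , aibk≡ , w≡ = y′ , t , u , trans aibi≡ (cong (y′ ++_) aibk≡) , w≡

module _ {f : Word → Word} (f[]≡[] : f [] ≡ []) (f-++ : ∀ u v → f (u ++ v) ≡ f u ++ f v) where

  data ImageSuffix (W s : Word) : Set where
    at-boundary : ∀ y w → W ≡ y ++ w → s ≡ f w → ImageSuffix W s
    inside      : ∀ y c w r q → W ≡ y ++ c ∷ w → f [ c ] ≡ r ++ q → r ≢ [] → q ≢ [] →
                  s ≡ q ++ f w → ImageSuffix W s

  imageSuffix : ∀ W x s → x ++ s ≡ f W → ImageSuffix W s
  imageSuffix [] x s eq =
    at-boundary [] [] refl (trans (++-conicalʳ x s (trans eq f[]≡[])) (sym f[]≡[]))
  imageSuffix (c ∷ W) x s eq with ++-≡-++ x s (f [ c ]) (f W) (trans eq (f-++ [ c ] W))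
  ... | inj₁ (m , _ , fW≡) with imageSuffix W m s (sym fW≡)
  ...   | at-boundary y w W≡ s≡       = at-boundary (c ∷ y) w (cong (c ∷_) W≡) s≡
  ...   | inside y d w r q W≡ fd≡ r≢[] q≢[] s≡ =
            inside (c ∷ y) d w r q (cong (c ∷_) W≡) fd≡ r≢[] q≢[] s≡
  imageSuffix (c ∷ W) []      s eq | inj₂ _               = at-boundary [] (c ∷ W) refl eq
  imageSuffix (c ∷ W) (_ ∷ _) s eq | inj₂ ([] , _ , s≡)    = at-boundary [ c ] W refl s≡
  imageSuffix (c ∷ W) (_ ∷ _) s eq | inj₂ (_ ∷ _ , fc≡ , s≡) =
    inside [] c W _ _ refl fc≡ ∷≢[] ∷≢[] s≡

  lyndon-image-≺-inner-suffix : ∀ {P r q} → IsLyndon (f P) → P ≡ y ++ c ∷ t →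
                                f [ c ] ≡ r ++ q → r ≢ [] → q ≢ [] →
                                ∀ X Y → (f P ++ X) ≺ ((q ++ f t) ++ Y)
  lyndon-image-≺-inner-suffix {y} {c} {t} {P} {r} {q} fP-lyndon P≡ fc≡ r≢[] q≢[] =
    lyndon-≺-suffix-++ fP-lyndon fP≡
      (λ e → r≢[] (++-conicalʳ (f y) r e)) (λ e → q≢[] (++-conicalˡ q (f t) e))
    where
    open ≡-Reasoning
    fP≡ : f P ≡ (f y ++ r) ++ (q ++ f t)
    fP≡ = begin
      f P                          ≡⟨ cong f P≡ ⟩
      f (y ++ c ∷ t)               ≡⟨ f-++ y (c ∷ t) ⟩
      f y ++ f (c ∷ t)             ≡⟨ cong (f y ++_) (f-++ [ c ] t) ⟩
      f y ++ (f [ c ] ++ f t)      ≡⟨ cong (λ fc → f y ++ (fc ++ f t)) fc≡ ⟩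
      f y ++ ((r ++ q) ++ f t)     ≡⟨ cong (f y ++_) (++-assoc r q (f t)) ⟩
      f y ++ (r ++ (q ++ f t))     ≡⟨ ++-assoc (f y) r (q ++ f t) ⟨
      (f y ++ r) ++ (q ++ f t)     ∎

  lyndon-image-aib-++ : PreservesLex f → ∀ i → IsLyndon (f (aib i)) →
                        ∀ v → IsLyndon (aib i ++ v) → IsLyndon (f (aib i ++ v))
  lyndon-image-aib-++ pres i p-lyndon@(p≢[] , _) v W-lyndon@(_ , W≺suffix) =
    fW≢[] , fW≺suffix
    where
    W = aib i ++ v

    fW≡ : f W ≡ f (aib i) ++ f v
    fW≡ = f-++ (aib i) v

    fW≢[] : f W ≢ []
    fW≢[] eq = p≢[] (++-conicalˡ (f (aib i)) (f v) (trans (sym fW≡) eq))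

    fW≺suffix : ∀ x s → x ++ s ≡ f W → x ≢ [] → s ≢ [] → f W ≺ s
    fW≺suffix x s eq x≢[] s≢[] with imageSuffix W x s eq
    ... | at-boundary [] w W≡ s≡ =
      contradiction (++-identityˡ-unique x (sym (trans eq (trans (cong f W≡) (sym s≡))))) x≢[]
    ... | at-boundary (_ ∷ _) [] _ s≡ = contradiction (trans s≡ f[]≡[]) s≢[]
    ... | at-boundary (d ∷ y) (c ∷ w) W≡ s≡ =
      subst (f W ≺_) (sym s≡) (pres W (c ∷ w) (W≺suffix (d ∷ y) (c ∷ w) (sym W≡) ∷≢[] ∷≢[]))
    ... | inside y c w r q W≡ fc≡ r≢[] q≢[] s≡ with lyndon-aib-++-suffix i W-lyndon W≡
    ... | y′ , t , u , aibi≡ , w≡ =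
      subst₂ _≺_ (sym fW≡) (sym s≡′)
        (lyndon-image-≺-inner-suffix p-lyndon aibi≡ fc≡ r≢[] q≢[] (f v) (f u))
      where
      s≡′ : s ≡ (q ++ f t) ++ f u
      s≡′ = trans s≡ (trans (cong (λ w → q ++ f w) w≡)
              (trans (cong (q ++_) (f-++ t u)) (sym (++-assoc q (f t) (f u)))))

lemma1 : (f : Word → Word) → IsEndomorphism f → PreservesLex f →
         (i : ℕ) → 2 ≤ i → IsLyndon (f (aib i)) →
         (v : Word) → IsLyndon (aib i ++ v) → IsLyndon (f (aib i ++ v))
lemma1 f (f[]≡[] , f-++) pres i _ = lyndon-image-aib-++ f[]≡[] f-++ pres i
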